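{- If $c$ is a superirredundant clause of a CNF formula $F$, then $c$ belongs to every minimal CNF formula equivalent to $F$.
   Context: A CNF formula is a finite set of clauses; a clause is a finite set of literals, read as their disjunction. Tautological clauses are not allowed in formulae. The size of a formula is the number of literal occurrences in it; a CNF formula $B$ is minimal if no CNF formula equivalent to $B$ has smaller size. Resolution: from clauses $c_1 \vee l$ and $c_2 \vee \neg l$ derive $c_1 \vee c_2$; two clauses whose resolvent would be a tautology are considered not to resolve. The resolution closure $\mathrm{ResCn}(F)$ is the set of all clauses obtainable from $F$ by zero or more resolution steps. A clause $c \in F$ is superredundant in $F$ if $\mathrm{ResCn}(F) \setminus \{c\} \models c$, and superirredundant otherwise. -}

module Defs where

open import Data.Nat using (ℕ; _≤_; _+_)
open import Data.Bool using (Bool; true; false; not)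
open import Data.List using (List; length; map)
open import Data.Nat.ListAction using (sum)
open import Data.List.Membership.Propositional using (_∈_)
open import Data.List.Relation.Unary.Unique.Propositional using (Unique)
open import Data.List.Relation.Unary.All using (All)
open import Data.List.Relation.Unary.AllPairs using (AllPairs)
open import Data.Product using (Σ; ∃; _×_; _,_)
open import Data.Sum using (_⊎_)
open import Relation.Binary.PropositionalEquality using (_≡_; _≢_)
open import Relation.Nullary using (¬_)

Var : Set
Var = ℕ

data Literal : Set where
  pos : Var → Literal
  neg : Var → Literal

~_ : Literal → Literal
~ pos x = neg x
~ neg x = pos x

-- A clause is a finite set of literals, represented by a list
-- (read as a set: only membership matters, except for size).
Clause : Set
Clause = List Literal

CNF : Set
CNF = List Clause

_≈C_ : Clause → Clause → Set
c ≈C d = ∀ l → (l ∈ c → l ∈ d) × (l ∈ d → l ∈ c)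

Tautology : Clause → Set
Tautology c = ∃ λ l → l ∈ c × (~ l) ∈ c

WFClause : Clause → Set
WFClause c = Unique c × ¬ Tautology c

WFCNF : CNF → Set
WFCNF F = All WFClause F × AllPairs (λ c d → ¬ (c ≈C d)) F

_∈F_ : Clause → CNF → Set
c ∈F F = ∃ λ d → d ∈ F × (d ≈C c)

size : CNF → ℕ
size F = sum (map length F)

Assignment : Set
Assignment = Var → Bool

evalLit : Assignment → Literal → Bool
evalLit a (pos x) = a x
evalLit a (neg x) = not (a x)

SatClause : Assignment → Clause → Set
SatClause a c = ∃ λ l → l ∈ c × evalLit a l ≡ true

SatCNF : Assignment → CNF → Set
SatCNF a F = ∀ c → c ∈ F → SatClause a c

Equivalent : CNF → CNF → Set
Equivalent F G = ∀ a → (SatCNF a F → SatCNF a G) × (SatCNF a G → SatCNF a F)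

Minimal : CNF → Set
Minimal B = WFCNF B × (∀ B' → WFCNF B' → Equivalent B B' → size B ≤ size B')

IsResolvent : Clause → Clause → Literal → Clause → Set
IsResolvent d1 d2 l r =
  l ∈ d1 × (~ l) ∈ d2 × ¬ Tautology r ×
  (∀ m → (m ∈ r → (m ∈ d1 × m ≢ l) ⊎ (m ∈ d2 × m ≢ ~ l))
       × ((m ∈ d1 × m ≢ l) ⊎ (m ∈ d2 × m ≢ ~ l) → m ∈ r))

data InResCn (F : CNF) : Clause → Set where
  base : ∀ {c} → c ∈F F → InResCn F c
  step : ∀ {d1 d2 r} l → InResCn F d1 → InResCn F d2 →
         IsResolvent d1 d2 l r → InResCn F r

Superredundant : CNF → Clause → Set
Superredundant F c =
  ∀ a → (∀ d → InResCn F d → ¬ (d ≈C c) → SatClause a d) → SatClause a c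

Superirredundant : CNF → Clause → Set
Superirredundant F c = ¬ Superredundant F c

-- Suppose c ∉ B and an assignment a satisfies every clause of ResCn(F) other
-- than c but falsifies c. Then a falsifies F, hence B, hence some d ∈ B. As
-- F ⊨ d, completeness of resolution for implicates yields e ∈ ResCn(F) with
-- e ⊆ d; since a falsifies d, e must be c. So c ⊆ d, and c ≠ d as c ∉ B;
-- replacing d by c in B gives a smaller equivalent formula, contradicting
-- minimality. Hence a satisfies c, i.e. c is superredundant.
module Submission where

open import Defs
open import Data.List.Membership.Propositional using (_∈_)

open import Function using (_∘_)
open import Data.Nat using (_≤_; _<_; _+_; z≤n; s≤s) renaming (_≟_ to _≟ℕ_)
open import Data.Nat.Properties
  using (≤-trans; ≤-reflexive; ≤-<-trans; <⇒≱; +-comm; +-assoc; +-monoʳ-≤; +-monoʳ-<; m≤n+m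
        ; module ≤-Reasoning)
open import Data.Bool using (true)
open import Data.Bool.Properties using () renaming (_≟_ to _≟𝔹_)
open import Data.List using (List; []; _∷_; length; filter; _++_; concat; map)
open import Data.List.Properties using (filter-notAll)
open import Data.List.Relation.Unary.Any as Any using (here; there; any?)
open import Data.List.Relation.Unary.All using (_∷_; all?; lookup; tabulate)
open import Data.List.Relation.Unary.All.Properties.Core using (¬All⇒Any¬)
open import Data.List.Relation.Unary.AllPairs using (_∷_)
import Data.List.Relation.Unary.All.Properties as All
import Data.List.Relation.Unary.AllPairs.Properties as AllPairs
open import Data.List.Relation.Unary.Unique.Propositional using (Unique)
open import Data.List.Relation.Binary.Subset.Propositional using (_⊆_)
open import Data.List.Relation.Binary.Subset.Propositional.Properties using (⊆-trans)
open import Data.List.Membership.Propositional using (_∉_; find; lose)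
open import Data.List.Membership.Propositional.Properties
  using (∈-filter⁺; ∈-filter⁻; ∈-++⁻; ∈-++⁺ˡ; ∈-++⁺ʳ; ∈-concat⁺′; ∈-map⁺)
open import Data.Product using (∃; _×_; _,_; proj₁; proj₂)
open import Data.Sum using (_⊎_; inj₁; inj₂; [_,_]′)
import Data.Sum as Sum
open import Data.Empty using (⊥-elim)
open import Relation.Nullary using (¬_; Dec; yes; no; does; ¬?)
open import Relation.Nullary.Decidable using (map′; decidable-stable)
open import Relation.Binary.Definitions using (DecidableEquality)
open import Relation.Binary.PropositionalEquality using (_≡_; _≢_; refl; sym; trans; cong; subst)

module _ {a} {A : Set a} (_≟_ : DecidableEquality A) where
  open import Data.List.Membership.DecPropositional _≟_ using (_∈?_)

  ⊈⇒∃∉ : ∀ {xs ys : List A} → ¬ xs ⊆ ys → ∃ λ x → x ∈ xs × x ∉ ys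
  ⊈⇒∃∉ {xs} {ys} xs⊈ys = find (¬All⇒Any¬ (_∈? ys) xs (λ all → xs⊈ys (lookup all)))

  private
    remove : A → List A → List A
    remove y = filter (λ z → ¬? (z ≟ y))

    length-remove< : ∀ {y ys} → y ∈ ys → length (remove y ys) < length ys
    length-remove< {y} {ys} y∈ys = filter-notAll (λ z → ¬? (z ≟ y)) ys (lose y∈ys λ y≢y → y≢y refl)

    ⊆-remove : ∀ {xs ys y} → xs ⊆ ys → y ∉ xs → xs ⊆ remove y ys
    ⊆-remove {xs} {y = y} xs⊆ys y∉xs x∈xs =
      ∈-filter⁺ (λ z → ¬? (z ≟ y)) (xs⊆ys x∈xs) λ x≡y → y∉xs (subst (_∈ xs) x≡y x∈xs)

  Unique-⊆⇒length≤ : ∀ {xs ys : List A} → Unique xs → xs ⊆ ys → length xs ≤ length ys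
  Unique-⊆⇒length≤ {[]} _ _ = z≤n
  Unique-⊆⇒length≤ {x ∷ xs} (x∉xs ∷ xs!) x∷xs⊆ys =
    ≤-trans (s≤s (Unique-⊆⇒length≤ xs! (⊆-remove (x∷xs⊆ys ∘ there) λ x∈xs → lookup x∉xs x∈xs refl)))
            (length-remove< (x∷xs⊆ys (here refl)))

  Unique-⊆-∉⇒length< : ∀ {xs ys : List A} {y} → Unique xs → xs ⊆ ys → y ∈ ys → y ∉ xs →
                       length xs < length ys
  Unique-⊆-∉⇒length< xs! xs⊆ys y∈ys y∉xs =
    ≤-<-trans (Unique-⊆⇒length≤ xs! (⊆-remove xs⊆ys y∉xs)) (length-remove< y∈ys)

_≟ₗ_ : DecidableEquality Literal
pos x ≟ₗ pos y = map′ (cong pos) (λ { refl → refl }) (x ≟ℕ y)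
pos x ≟ₗ neg y = no λ ()
neg x ≟ₗ pos y = no λ ()
neg x ≟ₗ neg y = map′ (cong neg) (λ { refl → refl }) (x ≟ℕ y)

open import Data.List.Membership.DecPropositional _≟ₗ_ using (_∈?_)
open import Data.List.Relation.Binary.Subset.DecPropositional _≟ₗ_ using (_⊆?_)

var : Literal → Var
var (pos x) = x
var (neg x) = x

~-involutive : ∀ l → ~ (~ l) ≡ l
~-involutive (pos x) = refl
~-involutive (neg x) = refl

~l≢l : ∀ l → ~ l ≢ l
~l≢l (pos x) ()
~l≢l (neg x) ()

var≡⇒≡⊎≡~ : ∀ {m l} → var m ≡ var l → l ≡ m ⊎ l ≡ ~ m
var≡⇒≡⊎≡~ {pos x} {pos .x} refl = inj₁ refl
var≡⇒≡⊎≡~ {pos x} {neg .x} refl = inj₂ refl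
var≡⇒≡⊎≡~ {neg x} {pos .x} refl = inj₂ refl
var≡⇒≡⊎≡~ {neg x} {neg .x} refl = inj₁ refl

var≡⇒∈⊎~∈ : ∀ {m l d} → var m ≡ var l → l ∈ d → m ∈ d ⊎ ~ m ∈ d
var≡⇒∈⊎~∈ {d = d} m~l l∈d =
  Sum.map (λ l≡ → subst (_∈ d) l≡ l∈d) (λ l≡ → subst (_∈ d) l≡ l∈d) (var≡⇒≡⊎≡~ m~l)

⊆⇒≈C : ∀ {c d} → c ⊆ d → d ⊆ c → c ≈C d
⊆⇒≈C c⊆d d⊆c l = c⊆d , d⊆c

≈C-refl : ∀ {c} → c ≈C c
≈C-refl l = (λ l∈ → l∈) , (λ l∈ → l∈)

≈C⇒⊆ : ∀ {c d} → c ≈C d → c ⊆ d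
≈C⇒⊆ c≈d = proj₁ (c≈d _)

≈C⇒⊇ : ∀ {c d} → c ≈C d → d ⊆ c
≈C⇒⊇ c≈d = proj₂ (c≈d _)

_≈C?_ : ∀ c d → Dec (c ≈C d)
c ≈C? d with c ⊆? d | d ⊆? c
... | yes c⊆d | yes d⊆c = yes (⊆⇒≈C c⊆d d⊆c)
... | no c⊈d  | _       = no (c⊈d ∘ ≈C⇒⊆)
... | yes _   | no d⊈c  = no (d⊈c ∘ ≈C⇒⊇)

_∈F?_ : ∀ c F → Dec (c ∈F F)
c ∈F? F = map′ find (λ { (d , d∈F , d≈c) → lose d∈F d≈c }) (any? (_≈C? c) F)

¬Tautology-⊆ : ∀ {c d} → c ⊆ d → ¬ Tautology d → ¬ Tautology c
¬Tautology-⊆ c⊆d ¬taut (l , l∈c , ~l∈c) = ¬taut (l , c⊆d l∈c , c⊆d ~l∈c)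

¬Tautology-∷ : ∀ {l d} → ¬ Tautology d → ~ l ∉ d → ¬ Tautology (l ∷ d)
¬Tautology-∷ {l} ¬taut ~l∉d (.l , here refl , here ~l≡l) = ~l≢l l ~l≡l
¬Tautology-∷ ¬taut ~l∉d (_ , here refl , there ~l∈d) = ~l∉d ~l∈d
¬Tautology-∷ {d = d} ¬taut ~l∉d (m , there m∈d , here ~m≡l) =
  ~l∉d (subst (_∈ d) (trans (sym (~-involutive m)) (cong ~_ ~m≡l)) m∈d)
¬Tautology-∷ ¬taut ~l∉d (m , there m∈d , there ~m∈d) = ¬taut (m , m∈d , ~m∈d)

satClause? : ∀ a c → Dec (SatClause a c)
satClause? a c =
  map′ find (λ { (l , l∈c , l-true) → lose l∈c l-true }) (any? (λ l → evalLit a l ≟𝔹 true) c)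

satClause-⊆ : ∀ {a c d} → c ⊆ d → SatClause a c → SatClause a d
satClause-⊆ c⊆d (l , l∈c , l-true) = l , c⊆d l∈c , l-true

satCNF⊎falsified : ∀ a F → SatCNF a F ⊎ ∃ λ d → d ∈ F × ¬ SatClause a d
satCNF⊎falsified a F with all? (satClause? a) F
... | yes all = inj₁ λ d d∈F → lookup all d∈F
... | no ¬all = inj₂ (find (¬All⇒Any¬ (satClause? a) F ¬all))

_⊨_ : CNF → Clause → Set
F ⊨ c = ∀ a → SatCNF a F → SatClause a c

Equivalent-sym : ∀ {F G} → Equivalent F G → Equivalent G F
Equivalent-sym F≡G a = proj₂ (F≡G a) , proj₁ (F≡G a)

Equivalent⇒⊨ : ∀ {F G c} → Equivalent F G → c ∈ G → F ⊨ c
Equivalent⇒⊨ F≡G c∈G a satF = proj₁ (F≡G a) satF _ c∈G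

WFCNF⇒WFClause : ∀ {F c} → WFCNF F → c ∈ F → WFClause c
WFCNF⇒WFClause (wf , _) c∈F = lookup wf c∈F

resolvent : Literal → Clause → Clause → Clause
resolvent l d₁ d₂ = filter (λ m → ¬? (m ≟ₗ l)) d₁ ++ filter (λ m → ¬? (m ≟ₗ (~ l))) d₂

∈-resolvent⁻ : ∀ {l d₁ d₂ m} → m ∈ resolvent l d₁ d₂ → (m ∈ d₁ × m ≢ l) ⊎ (m ∈ d₂ × m ≢ ~ l)
∈-resolvent⁻ {l} {d₁} m∈r =
  Sum.map (∈-filter⁻ (λ m → ¬? (m ≟ₗ l))) (∈-filter⁻ (λ m → ¬? (m ≟ₗ (~ l)))) (∈-++⁻ _ m∈r)

∈-resolvent⁺ : ∀ {l d₁ d₂ m} → (m ∈ d₁ × m ≢ l) ⊎ (m ∈ d₂ × m ≢ ~ l) → m ∈ resolvent l d₁ d₂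
∈-resolvent⁺ {l} {d₁} =
  [ (λ { (m∈ , m≢) → ∈-++⁺ˡ (∈-filter⁺ (λ m → ¬? (m ≟ₗ l)) m∈ m≢) })
  , (λ { (m∈ , m≢) → ∈-++⁺ʳ _ (∈-filter⁺ (λ m → ¬? (m ≟ₗ (~ l))) m∈ m≢) }) ]′

resolvent-⊆ : ∀ {l d₁ d₂ d} → d₁ ⊆ l ∷ d → d₂ ⊆ ~ l ∷ d → resolvent l d₁ d₂ ⊆ d
resolvent-⊆ d₁⊆ d₂⊆ m∈r with ∈-resolvent⁻ m∈r
... | inj₁ (m∈d₁ , m≢l)  = Any.tail m≢l (d₁⊆ m∈d₁)
... | inj₂ (m∈d₂ , m≢~l) = Any.tail m≢~l (d₂⊆ m∈d₂)

resolvent-IsResolvent : ∀ {l d₁ d₂} → l ∈ d₁ → ~ l ∈ d₂ → ¬ Tautology (resolvent l d₁ d₂) →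
                        IsResolvent d₁ d₂ l (resolvent l d₁ d₂)
resolvent-IsResolvent l∈d₁ ~l∈d₂ ¬taut = l∈d₁ , ~l∈d₂ , ¬taut , λ m → ∈-resolvent⁻ , ∈-resolvent⁺

⊆-∷-∉ : ∀ {l : Literal} {c d : Clause} → c ⊆ l ∷ d → l ∉ c → c ⊆ d
⊆-∷-∉ {c = c} c⊆ l∉c m∈c = Any.tail (λ m≡l → l∉c (subst (_∈ c) m≡l m∈c)) (c⊆ m∈c)

module Completeness (F : CNF) where

  Subsumed : Clause → Set
  Subsumed d = ∃ λ e → InResCn F e × e ⊆ d

  Falsifiable : Clause → Set
  Falsifiable d = ∃ λ a → SatCNF a F × ¬ SatClause a d

  Covers : List Var → Clause → Set
  Covers vs d = ∀ {f m} → f ∈ F → m ∈ f → var m ∈ vs ⊎ (m ∈ d ⊎ ~ m ∈ d)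

  Covers-drop : ∀ {l vs d} → l ∈ d → Covers (var l ∷ vs) d → Covers vs d
  Covers-drop l∈d cov f∈F m∈f with cov f∈F m∈f
  ... | inj₁ (here m~l)  = inj₂ (var≡⇒∈⊎~∈ m~l l∈d)
  ... | inj₁ (there m∈vs) = inj₁ m∈vs
  ... | inj₂ decided     = inj₂ decided

  Covers-∷ : ∀ {l vs d} → Covers (var l ∷ vs) d → Covers vs (l ∷ d)
  Covers-∷ cov f∈F m∈f with cov f∈F m∈f
  ... | inj₁ (here m~l)  = inj₂ (var≡⇒∈⊎~∈ m~l (here refl))
  ... | inj₁ (there m∈vs) = inj₁ m∈vs
  ... | inj₂ decided     = inj₂ (Sum.map there there decided)

  vars : List Var
  vars = concat (map (map var) F)

  Covers-vars : ∀ d → Covers vars d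
  Covers-vars d f∈F m∈f = inj₁ (∈-concat⁺′ (∈-map⁺ var m∈f) (∈-map⁺ (map var) f∈F))

  falsifier : Clause → Assignment
  falsifier d x = does (neg x ∈? d)

  falsifier-falsifies : ∀ {d} → ¬ Tautology d → ¬ SatClause (falsifier d) d
  falsifier-falsifies {d} ¬taut (pos x , x∈d , sat) with neg x ∈? d | sat
  ... | yes ¬x∈d | _ = ¬taut (pos x , x∈d , ¬x∈d)
  ... | no _     | ()
  falsifier-falsifies {d} ¬taut (neg x , ¬x∈d , sat) with neg x ∈? d | sat
  ... | yes _    | ()
  ... | no ¬x∉d  | _ = ¬x∉d ¬x∈d

  falsifier-satisfies : ∀ {d m} → ¬ Tautology d → ~ m ∈ d → evalLit (falsifier d) m ≡ true
  falsifier-satisfies {d} {pos x} ¬taut ¬x∈d with neg x ∈? d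
  ... | yes _   = refl
  ... | no ¬x∉d = ⊥-elim (¬x∉d ¬x∈d)
  falsifier-satisfies {d} {neg x} ¬taut x∈d with neg x ∈? d
  ... | yes ¬x∈d = ⊥-elim (¬taut (pos x , x∈d , ¬x∈d))
  ... | no _     = refl

  -- If no clause of F lies inside d, the falsifier of d satisfies F: each clause
  -- has a literal outside d, and d decides its variable, so d contains its complement.
  subsumed⊎falsifiable-decided : ∀ {d} → ¬ Tautology d → Covers [] d → Subsumed d ⊎ Falsifiable d
  subsumed⊎falsifiable-decided {d} ¬taut cov with any? (_⊆? d) F
  ... | yes some⊆d = let f , f∈F , f⊆d = find some⊆d in
                     inj₁ (f , base (f , f∈F , ≈C-refl) , f⊆d)
  ... | no none⊆d = inj₂ (falsifier d , satF , falsifier-falsifies ¬taut)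
    where
    satF : SatCNF (falsifier d) F
    satF f f∈F with ⊈⇒∃∉ _≟ₗ_ {f} {d} (λ f⊆d → none⊆d (lose f∈F f⊆d))
    ... | m , m∈f , m∉d with cov f∈F m∈f
    ...   | inj₂ (inj₁ m∈d)  = ⊥-elim (m∉d m∈d)
    ...   | inj₂ (inj₂ ~m∈d) = m , m∈f , falsifier-satisfies ¬taut ~m∈d

  resolve-on : ∀ {d} l → ¬ Tautology d → Subsumed (l ∷ d) → Subsumed (~ l ∷ d) → Subsumed d
  resolve-on l ¬taut (e₁ , e₁∈ , e₁⊆) (e₂ , e₂∈ , e₂⊆) with l ∈? e₁ | ~ l ∈? e₂
  ... | no l∉e₁   | _          = e₁ , e₁∈ , ⊆-∷-∉ e₁⊆ l∉e₁
  ... | yes _     | no ~l∉e₂   = e₂ , e₂∈ , ⊆-∷-∉ e₂⊆ ~l∉e₂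
  ... | yes l∈e₁  | yes ~l∈e₂  =
    resolvent l e₁ e₂ ,
    step l e₁∈ e₂∈ (resolvent-IsResolvent l∈e₁ ~l∈e₂ (¬Tautology-⊆ r⊆d ¬taut)) ,
    r⊆d
    where r⊆d = resolvent-⊆ e₁⊆ e₂⊆

  falsifiable-∷ : ∀ {l d} → Falsifiable (l ∷ d) → Falsifiable d
  falsifiable-∷ (a , satF , ¬sat) = a , satF , ¬sat ∘ satClause-⊆ there

  subsumed⊎falsifiable : ∀ vs {d} → ¬ Tautology d → Covers vs d → Subsumed d ⊎ Falsifiable d
  subsumed⊎falsifiable [] ¬taut cov = subsumed⊎falsifiable-decided ¬taut cov
  subsumed⊎falsifiable (x ∷ vs) {d} ¬taut cov with pos x ∈? d | neg x ∈? d
  ... | yes x∈d | _        = subsumed⊎falsifiable vs ¬taut (Covers-drop x∈d cov)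
  ... | no _    | yes ¬x∈d = subsumed⊎falsifiable vs ¬taut (Covers-drop ¬x∈d cov)
  ... | no x∉d  | no ¬x∉d
    with subsumed⊎falsifiable vs (¬Tautology-∷ ¬taut ¬x∉d) (Covers-∷ cov)
       | subsumed⊎falsifiable vs (¬Tautology-∷ ¬taut x∉d) (Covers-∷ cov)
  ...   | inj₂ fal | _        = inj₂ (falsifiable-∷ fal)
  ...   | inj₁ _   | inj₂ fal = inj₂ (falsifiable-∷ fal)
  ...   | inj₁ s₁  | inj₁ s₂  = inj₁ (resolve-on (pos x) ¬taut s₁ s₂)

  resolution-complete : ∀ {d} → ¬ Tautology d → F ⊨ d → Subsumed d
  resolution-complete {d} ¬taut F⊨d
    with subsumed⊎falsifiable vars ¬taut (Covers-vars d)
  ... | inj₁ subsumed        = subsumed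
  ... | inj₂ (a , satF , ¬sat) = ⊥-elim (¬sat (F⊨d a satF))

open Completeness using (resolution-complete)

without : Clause → CNF → CNF
without d = filter (λ f → ¬? (f ≈C? d))

∈-without⁻ : ∀ {d f B} → f ∈ without d B → f ∈ B
∈-without⁻ {d} = proj₁ ∘ ∈-filter⁻ (λ f → ¬? (f ≈C? d))

size-without≤ : ∀ d B → size (without d B) ≤ size B
size-without≤ d [] = z≤n
size-without≤ d (e ∷ B) with e ≈C? d
... | yes _ = ≤-trans (size-without≤ d B) (m≤n+m _ (length e))
... | no _  = +-monoʳ-≤ (length e) (size-without≤ d B)

size-without : ∀ {d B} → d ∈ B → size (without d B) + length d ≤ size B
size-without {d} {e ∷ B} (here refl) with e ≈C? e
... | yes _  = ≤-trans (≤-reflexive (+-comm (size (without e B)) (length e)))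
                       (+-monoʳ-≤ (length e) (size-without≤ e B))
... | no e≉e = ⊥-elim (e≉e ≈C-refl)
size-without {d} {e ∷ B} (there d∈B) with e ≈C? d
... | yes _ = ≤-trans (size-without d∈B) (m≤n+m _ (length e))
... | no _  = ≤-trans (≤-reflexive (+-assoc (length e) (size (without d B)) (length d)))
                      (+-monoʳ-≤ (length e) (size-without d∈B))

WFCNF-without : ∀ {d B} → WFCNF B → WFCNF (without d B)
WFCNF-without {d} (wf , distinct) =
  All.filter⁺ (λ f → ¬? (f ≈C? d)) wf , AllPairs.filter⁺ (λ f → ¬? (f ≈C? d)) distinct

WFCNF-∷ : ∀ {c B} → WFClause c → ¬ c ∈F B → WFCNF B → WFCNF (c ∷ B)
WFCNF-∷ wfc c∉B (wf , distinct) =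
  wfc ∷ wf , tabulate (λ f∈B c≈f → c∉B (_ , f∈B , ⊆⇒≈C (≈C⇒⊇ c≈f) (≈C⇒⊆ c≈f))) ∷ distinct

replace-equivalent : ∀ {B c d} → B ⊨ c → c ⊆ d → Equivalent B (c ∷ without d B)
replace-equivalent {B} {c} {d} B⊨c c⊆d a = to , from
  where
  to : SatCNF a B → SatCNF a (c ∷ without d B)
  to satB _ (here refl) = B⊨c a satB
  to satB f (there f∈) = satB f (∈-without⁻ f∈)
  from : SatCNF a (c ∷ without d B) → SatCNF a B
  from satB' f f∈B with f ≈C? d
  ... | yes f≈d = satClause-⊆ (⊆-trans c⊆d (≈C⇒⊇ f≈d)) (satB' c (here refl))
  ... | no f≉d  = satB' f (there (∈-filter⁺ (λ f → ¬? (f ≈C? d)) f∈B f≉d))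

-- In a minimal formula, an implicate that is a proper subclause of a member
-- could replace that member and make the formula smaller.
minimal-implicate⊆member⇒∈F : ∀ {B c d} → Minimal B → WFClause c → B ⊨ c → c ⊆ d → d ∈ B → c ∈F B
minimal-implicate⊆member⇒∈F {B} {c} {d} (wfB , minB) wfc B⊨c c⊆d d∈B with c ∈F? B | d ⊆? c
... | yes c∈B | _      = c∈B
... | no _    | yes d⊆c = d , d∈B , ⊆⇒≈C d⊆c c⊆d
... | no c∉B  | no d⊈c  = ⊥-elim (<⇒≱ smaller (minB B′ wfB′ (replace-equivalent B⊨c c⊆d)))
  where
  B′ = c ∷ without d B
  wfB′ : WFCNF B′
  wfB′ = WFCNF-∷ wfc (λ { (f , f∈ , f≈c) → c∉B (f , ∈-without⁻ f∈ , f≈c) }) (WFCNF-without wfB)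
  c<d : length c < length d
  c<d = let m , m∈d , m∉c = ⊈⇒∃∉ _≟ₗ_ d⊈c in Unique-⊆-∉⇒length< _≟ₗ_ (proj₁ wfc) c⊆d m∈d m∉c
  smaller : size B′ < size B
  smaller = begin-strict
    length c + size (without d B) ≡⟨ +-comm (length c) _ ⟩
    size (without d B) + length c <⟨ +-monoʳ-< (size (without d B)) c<d ⟩
    size (without d B) + length d ≤⟨ size-without d∈B ⟩
    size B                        ∎
    where open ≤-Reasoning

∉F-minimal⇒superredundant : ∀ {F B c} → WFCNF F → c ∈ F → Minimal B → Equivalent B F → ¬ c ∈F B →
                             Superredundant F c
∉F-minimal⇒superredundant {F} {B} {c} wfF c∈F minB B≡F c∉B a satRes with satClause? a c
... | yes satc = satc
... | no ¬satc with satCNF⊎falsified a B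
...   | inj₁ satB = ⊥-elim (¬satc (Equivalent⇒⊨ B≡F c∈F a satB))
...   | inj₂ (d , d∈B , ¬satd)
  with resolution-complete F (proj₂ (WFCNF⇒WFClause (proj₁ minB) d∈B))
                             (Equivalent⇒⊨ (Equivalent-sym B≡F) d∈B)
...     | e , e∈Res , e⊆d with e ≈C? c
...       | no e≉c  = ⊥-elim (¬satd (satClause-⊆ e⊆d (satRes e e∈Res e≉c)))
...       | yes e≈c = ⊥-elim (c∉B (minimal-implicate⊆member⇒∈F minB (WFCNF⇒WFClause wfF c∈F)
                                     (Equivalent⇒⊨ B≡F c∈F) (⊆-trans (≈C⇒⊇ e≈c) e⊆d) d∈B))

lemma2 : (F : CNF) → WFCNF F → (c : Clause) → c ∈ F →
    Superirredundant F c →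
    (B : CNF) → Minimal B → Equivalent B F → c ∈F B
lemma2 F wfF c c∈F sirr B minB B≡F =
  decidable-stable (c ∈F? B) (sirr ∘ ∉F-minimal⇒superredundant wfF c∈F minB B≡F)
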